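{- Let $\ell\geqslant 2$ and let $q_2>q_3>\cdots>q_\ell$ be distinct odd primes. Then \[\frac{1}{q_2-2}+\frac{1}{(q_2-2)(q_3-2)}+\cdots+\frac{1}{(q_2-2)(q_3-2)\cdots(q_\ell-2)}\leqslant 1.\]
   Context: In the paper $q_1>q_2>\cdots>q_\ell$ are the prime factors of an odd square-free integer; only $q_2,\dots,q_\ell$ enter the statement. -}

module Defs where

open import Data.Nat as ℕ using (ℕ; zero; suc; _∸_)
open import Data.Integer using (+_)
open import Data.Rational using (ℚ; 0ℚ; _+_; _/_)
open import Data.List using (List; []; _∷_; map)

-- Reciprocal of a natural number as a rational; the value at 0 is an
-- arbitrary convention (0) and never used under the theorem's hypotheses,
-- since every factor q - 2 with q an odd prime is ≥ 1.
recipℕ : ℕ → ℚ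
recipℕ zero    = 0ℚ
recipℕ (suc n) = (+ 1) / suc n

-- Given the list q₂, …, q_ℓ, the sum over j = 2..ℓ of
--   1 / ((q₂ - 2)(q₃ - 2)⋯(q_j - 2)).
-- partialSum acc qs adds 1/(acc·∏(prefix)) for each nonempty prefix of qs.
partialSum : ℕ → List ℕ → ℚ
partialSum acc []       = 0ℚ
partialSum acc (q ∷ qs) = recipℕ (acc ℕ.* (q ∸ 2)) + partialSum (acc ℕ.* (q ∸ 2)) qs

lemmaSum : List ℕ → ℚ
lemmaSum qs = partialSum 1 qs

-- Write m = acc·(q₂ − 2) for the first denominator. If the list continues,
-- q₂ > q₃ ≥ 3 forces q₂ − 2 ≥ 2, so m ≥ 2·acc, and by induction the tail after
-- the first term is at most 1/m; hence the whole sum is at most 2/m ≤ 1/acc.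
-- Starting from acc = 1 gives the bound 1.

module Submission where

open import Defs
open import Data.Nat using (ℕ; suc; NonZero; _>_; _∸_; s≤s)
import Data.Nat as ℕ
import Data.Nat.Properties as ℕ
open import Data.Nat.Solver using (module +-*-Solver)
open import Data.Integer using (+_; +≤+)
open import Data.Rational using (0ℚ; 1ℚ; _+_; _≤_; toℚᵘ)
open import Data.Rational.Properties
  using (toℚᵘ-fromℚᵘ; toℚᵘ-cancel-≤; toℚᵘ-homo-+; ≤-refl; +-identityʳ; +-monoʳ-≤; module ≤-Reasoning)
open import Data.Rational.Unnormalised as ℚᵘ using (mkℚᵘ; *≤*)
import Data.Rational.Unnormalised.Properties as ℚᵘ
open import Data.Nat.Primality using (Prime; prime⇒nonTrivial)
open import Data.Nat.Divisibility using (_∣_; _∤_; ∣-refl)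
open import Data.List using (List; []; _∷_; length)
open import Data.List.Relation.Unary.All as All using (All; []; _∷_)
open import Data.List.Relation.Unary.Linked using (Linked; []; [-]; _∷_)
open import Data.Product using (_×_; uncurry)
open import Relation.Binary.PropositionalEquality using (_≡_; refl; sym; cong; subst; subst₂)

recipℕ-toℚᵘ : ∀ n → toℚᵘ (recipℕ (suc n)) ℚᵘ.≃ mkℚᵘ (+ 1) n
recipℕ-toℚᵘ n = toℚᵘ-fromℚᵘ (mkℚᵘ (+ 1) n)

recipℕ-nonNeg : ∀ n → 0ℚ ≤ recipℕ n
recipℕ-nonNeg ℕ.zero    = ≤-refl
recipℕ-nonNeg (suc n) = toℚᵘ-cancel-≤ (begin
  toℚᵘ 0ℚ          ≤⟨ *≤* (+≤+ ℕ.z≤n) ⟩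
  mkℚᵘ (+ 1) n     ≃⟨ recipℕ-toℚᵘ n ⟨
  toℚᵘ (recipℕ (suc n)) ∎)
  where open ℚᵘ.≤-Reasoning

recipℕ-antimono : ∀ {m n} .{{_ : NonZero m}} → m ℕ.≤ n → recipℕ n ≤ recipℕ m
recipℕ-antimono {suc m} {suc n} m≤n = toℚᵘ-cancel-≤ (begin
  toℚᵘ (recipℕ (suc n)) ≃⟨ recipℕ-toℚᵘ n ⟩
  mkℚᵘ (+ 1) n          ≤⟨ *≤* (+≤+ (ℕ.*-monoʳ-≤ 1 m≤n)) ⟩
  mkℚᵘ (+ 1) m          ≃⟨ recipℕ-toℚᵘ m ⟨
  toℚᵘ (recipℕ (suc m)) ∎)
  where open ℚᵘ.≤-Reasoning

2m≤n⇒[n+n]*m≤n*n : ∀ {m n} → 2 ℕ.* m ℕ.≤ n → (n ℕ.+ n) ℕ.* m ℕ.≤ n ℕ.* n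
2m≤n⇒[n+n]*m≤n*n {m} {n} 2m≤n = begin
  (n ℕ.+ n) ℕ.* m ≡⟨ solve 2 (λ m n → (n :+ n) :* m := n :* (con 2 :* m)) refl m n ⟩
  n ℕ.* (2 ℕ.* m) ≤⟨ ℕ.*-monoʳ-≤ n 2m≤n ⟩
  n ℕ.* n         ∎
  where open ℕ.≤-Reasoning; open +-*-Solver

recipℕ-double-≤ : ∀ {m n} .{{_ : NonZero m}} → 2 ℕ.* m ℕ.≤ n → recipℕ n + recipℕ n ≤ recipℕ m
recipℕ-double-≤ {suc m} {suc n} 2m≤n = toℚᵘ-cancel-≤ (begin
  toℚᵘ (recipℕ (suc n) + recipℕ (suc n))          ≃⟨ toℚᵘ-homo-+ (recipℕ (suc n)) (recipℕ (suc n)) ⟩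
  toℚᵘ (recipℕ (suc n)) ℚᵘ.+ toℚᵘ (recipℕ (suc n)) ≃⟨ ℚᵘ.+-cong (recipℕ-toℚᵘ n) (recipℕ-toℚᵘ n) ⟩
  mkℚᵘ (+ 1) n ℚᵘ.+ mkℚᵘ (+ 1) n                  ≤⟨ *≤* (+≤+ unit-numerators) ⟩
  mkℚᵘ (+ 1) m                                      ≃⟨ recipℕ-toℚᵘ m ⟨
  toℚᵘ (recipℕ (suc m)) ∎)
  where
  open ℚᵘ.≤-Reasoning
  unit-numerators : (1 ℕ.* suc n ℕ.+ 1 ℕ.* suc n) ℕ.* suc m ℕ.≤ 1 ℕ.* (suc n ℕ.* suc n)
  unit-numerators = subst₂ ℕ._≤_
    (cong (λ k → (k ℕ.+ k) ℕ.* suc m) (sym (ℕ.*-identityˡ (suc n))))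
    (sym (ℕ.*-identityˡ (suc n ℕ.* suc n)))
    (2m≤n⇒[n+n]*m≤n*n 2m≤n)

∸2-nonZero : ∀ {q} → 3 ℕ.≤ q → NonZero (q ∸ 2)
∸2-nonZero 3≤q = ℕ.>-nonZero (ℕ.∸-monoˡ-≤ 2 3≤q)

partialSum-≤ : ∀ acc .{{_ : NonZero acc}} (qs : List ℕ) → All (3 ℕ.≤_) qs → Linked _>_ qs →
               partialSum acc qs ≤ recipℕ acc
partialSum-≤ acc []            []              []              = recipℕ-nonNeg acc
partialSum-≤ acc (q ∷ [])      (3≤q ∷ [])      [-]             = begin
  recipℕ (acc ℕ.* (q ∸ 2)) + 0ℚ ≡⟨ +-identityʳ _ ⟩
  recipℕ (acc ℕ.* (q ∸ 2))      ≤⟨ recipℕ-antimono (ℕ.m≤m*n acc (q ∸ 2) {{∸2-nonZero 3≤q}}) ⟩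
  recipℕ acc                    ∎
  where open ≤-Reasoning
partialSum-≤ acc (q ∷ q′ ∷ qs) (3≤q ∷ 3≤q′∷qs@(3≤q′ ∷ _)) (q>q′ ∷ q′∷qs↓) = begin
  recipℕ m + partialSum m (q′ ∷ qs) ≤⟨ +-monoʳ-≤ (recipℕ m) (partialSum-≤ m (q′ ∷ qs) 3≤q′∷qs q′∷qs↓) ⟩
  recipℕ m + recipℕ m               ≤⟨ recipℕ-double-≤ 2acc≤m ⟩
  recipℕ acc                        ∎
  where
  open ≤-Reasoning
  m : ℕ
  m = acc ℕ.* (q ∸ 2)
  instance
    q∸2-nonZero : NonZero (q ∸ 2)
    q∸2-nonZero = ∸2-nonZero 3≤q
    m-nonZero : NonZero m
    m-nonZero = ℕ.m*n≢0 acc (q ∸ 2)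
  2≤q∸2 : 2 ℕ.≤ q ∸ 2
  2≤q∸2 = ℕ.∸-monoˡ-≤ 2 (ℕ.≤-trans (s≤s 3≤q′) q>q′)
  2acc≤m : 2 ℕ.* acc ℕ.≤ m
  2acc≤m = ℕ.≤-trans (ℕ.≤-reflexive (ℕ.*-comm 2 acc)) (ℕ.*-monoʳ-≤ acc 2≤q∸2)

odd-prime⇒3≤ : ∀ {p} → Prime p → 2 ∤ p → 3 ℕ.≤ p
odd-prime⇒3≤ {p} p-prime 2∤p = ℕ.≤∧≢⇒< (ℕ.nonTrivial⇒n>1 p {{prime⇒nonTrivial p-prime}})
  (λ 2≡p → 2∤p (subst (2 ∣_) 2≡p ∣-refl))

lemma40 : (ℓ : ℕ) → ℓ Data.Nat.≥ 2 → (qs : List ℕ) → length qs ≡ ℓ Data.Nat.∸ 1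
          → All (λ q → Prime q × 2 ∤ q) qs → Linked _>_ qs
          → lemmaSum qs ≤ 1ℚ
lemma40 _ _ qs _ odd-primes decreasing =
  partialSum-≤ 1 qs (All.map (uncurry odd-prime⇒3≤) odd-primes) decreasing
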